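{- Let $G=(V,E,\ell)$ be a weighted graph and let $\Phi=(I,T,\mathcal{C})$ be an interface of $G$. Then $G$ admits a $\Phi$-tour if and only if all of the following hold: (1) each connected component of $G$ contains an even number of vertices of $T$; (2) $G/I$ is connected; (3) for every $C\in\mathcal{C}$, the vertices of $C$ lie in the same connected component of $G$.
   Context: A weighted graph $G=(V,E,\ell)$ is an undirected graph without loops or parallel edges with $\ell:E\to\mathbb{R}_{\ge0}$. Multi-sets $F$ of edges of $E$ are allowed (written $F\subseteq E$); $\mathrm{odd}(F)$ is the set of vertices of odd degree in $(V,F)$. $G/I$ denotes the graph obtained by contracting the vertex set $I$ (with $G/\emptyset=G$). An interface of $G$ is a triple $\Phi=(I,T,\mathcal{C})$ with $T\subseteq I\subseteq V$, $|T|$ even, and $\mathcal{C}$ a partition of $I$. A $\Phi$-tour in $G$ is a multi-set $F\subseteq E$ such that $\mathrm{odd}(F)=T$, $(V,F)/I$ is connected, and for every $C\in\mathcal{C}$ all vertices of $C$ lie in the same connected component of $(V,F)$.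
   Formalization: The edge weights ℓ are nonnegative rationals rather than nonnegative reals. -}

module Defs where

open import Data.Nat using (ℕ; zero; suc; _+_; _%_)
open import Data.Fin using (Fin)
open import Data.Fin.Properties using (_≟_)
open import Data.Fin.Subset using (Subset; _∈_; _∉_; _⊆_; ∣_∣)
import Data.Fin.Subset as S
open import Data.Product using (_×_; _,_; Σ; ∃)
open import Data.List using (List; []; _∷_)
open import Data.List.Relation.Unary.All using (All)
open import Data.List.Relation.Unary.Unique.Propositional using (Unique)
import Data.List.Membership.Propositional as LM
open import Data.Rational using (ℚ; 0ℚ) renaming (_≤_ to _≤ℚ_)
open import Relation.Binary.PropositionalEquality using (_≡_; _≢_)
open import Relation.Nullary using (¬_; yes; no)
open import Function.Bundles using (_⇔_)

-- An edge is an (ordered representation of an) unordered pair of vertices.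
Edge : ℕ → Set
Edge n = Fin n × Fin n

record WGraph (n : ℕ) : Set where
  field
    edges        : List (Edge n)
    noLoops      : All (λ e → Data.Product.proj₁ e ≢ Data.Product.proj₂ e) edges
    noDup        : Unique edges
    noReverse    : ∀ u v → (u , v) LM.∈ edges → ¬ ((v , u) LM.∈ edges)
    ℓ            : Edge n → ℚ
    ℓ-nonneg     : ∀ e → 0ℚ ≤ℚ ℓ e
open WGraph public

Even : ℕ → Set
Even k = k % 2 ≡ 0

Odd : ℕ → Set
Odd k = k % 2 ≡ 1

-- Reachability in (Fin n, L) / I : L is a list (multi-set) of edges; vertices
-- of I are identified (contracted). With I = ⊥ this is ordinary reachability.
data ReachMod {n : ℕ} (L : List (Edge n)) (I : Subset n) : Fin n → Fin n → Set where
  here  : ∀ {u} → ReachMod L I u u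
  fwd   : ∀ {u v w} → (u , v) LM.∈ L → ReachMod L I v w → ReachMod L I u w
  bwd   : ∀ {u v w} → (v , u) LM.∈ L → ReachMod L I v w → ReachMod L I u w
  jump  : ∀ {u v w} → u ∈ I → v ∈ I → ReachMod L I v w → ReachMod L I u w

Reach : ∀ {n} → List (Edge n) → Fin n → Fin n → Set
Reach L = ReachMod L S.⊥

ConnectedMod : ∀ {n} → List (Edge n) → Subset n → Set
ConnectedMod {n} L I = ∀ (u v : Fin n) → ReachMod L I u v

ind : ∀ {n} → Fin n → Fin n → ℕ
ind u v with u ≟ v
... | yes _ = 1
... | no _  = 0

deg : ∀ {n} → List (Edge n) → Fin n → ℕ
deg []             v = 0
deg ((a , b) ∷ L)  v = ind a v + ind b v + deg L v

OddSetIs : ∀ {n} → List (Edge n) → Subset n → Set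
OddSetIs {n} F T = ∀ (v : Fin n) → (Odd (deg F v) ⇔ v ∈ T)

IsPartition : ∀ {n} → List (Subset n) → Subset n → Set
IsPartition {n} 𝒞 I =
  (∀ {C} → C LM.∈ 𝒞 → ∃ λ (v : Fin n) → v ∈ C) ×
  (∀ {C D} → C LM.∈ 𝒞 → D LM.∈ 𝒞 → ∀ (v : Fin n) → v ∈ C → v ∈ D → C ≡ D) ×
  (∀ (v : Fin n) → v ∈ I ⇔ (∃ λ C → C LM.∈ 𝒞 × v ∈ C))

record Interface {n : ℕ} (G : WGraph n) : Set where
  field
    I     : Subset n
    T     : Subset n
    𝒞     : List (Subset n)
    T⊆I   : T ⊆ I
    T-even : Even ∣ T ∣
    𝒞-part : IsPartition 𝒞 I
open Interface public

IsTour : ∀ {n} (G : WGraph n) → Interface G → List (Edge n) → Set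
IsTour {n} G Φ F =
  All (λ e → e LM.∈ edges G) F ×
  OddSetIs F (T Φ) ×
  ConnectedMod F (I Φ) ×
  (∀ {C} → C LM.∈ 𝒞 Φ → ∀ (u v : Fin n) → u ∈ C → v ∈ C → Reach F u v)

HasTour : ∀ {n} (G : WGraph n) → Interface G → Set
HasTour G Φ = ∃ λ F → IsTour G Φ F

CompsEvenT : ∀ {n} (G : WGraph n) → Subset n → Set
CompsEvenT {n} G T = ∀ (v : Fin n) →
  Σ (Subset n) λ S → (∀ (w : Fin n) → (w ∈ S ⇔ (w ∈ T × Reach (edges G) v w))) × Even ∣ S ∣

-- A multiset F ⊆ E with odd(F) = T (a T-join) exists iff every component of G
-- meets T evenly. Necessity is the handshake lemma mod 2 inside a component:
-- summing deg_F over a component counts every edge of F in it twice. For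
-- sufficiency, join each t ∈ T by a walk to the first vertex of T in its
-- component; that vertex is the endpoint of one walk for each vertex of T in the
-- component, an even number, so exactly T has odd degree. A Φ-tour is then such
-- a T-join plus two copies of E: the copies change no parity and give the tour
-- the reachability of G, which is what conditions (2) and (3) ask for.

module Submission where

open import Defs
open import Data.Bool using (true; false; if_then_else_; _∧_)
open import Data.Empty using (⊥-elim)
open import Data.Fin using (Fin; zero; suc)
open import Data.Fin.Properties using (_≟_; any?; suc-injective)
open import Data.Fin.Subset using (Subset; _∈_; _∉_; _∩_; ∣_∣; inside; outside)
open import Data.Fin.Subset.Properties using (_∈?_; ∉⊥; ⊆-antisym; nonempty?; x∈p∩q⁺; x∈p∩q⁻)
open import Data.List using (List; []; _∷_; _++_; concat; tabulate)
import Data.List.Membership.Propositional as LM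
open import Data.List.Membership.Propositional.Properties using (∈-++⁺ˡ)
open import Data.List.Relation.Unary.All as All using (All; []; _∷_)
open import Data.List.Relation.Unary.All.Properties using (++⁺; concat⁺; tabulate⁺)
open import Data.List.Relation.Unary.Any using (here; there)
open import Data.Nat as ℕ using (ℕ; parity)
open import Data.Parity.Base using (Parity; 0ℙ; 1ℙ) renaming (_+_ to infixl 6 _+_; _*_ to infixl 7 _*_)
open import Data.Parity.Properties
  using (+-0-commutativeMonoid; +-homo-+; +-assoc; +-comm; +-identityʳ; p+p≡0ℙ;
         *-identityʳ; *-zeroʳ; *-distribˡ-+)
open import Data.Product using (_×_; _,_; ∃; proj₁; proj₂)
open import Data.Sum using (_⊎_; inj₁; inj₂)
open import Data.Vec as Vec using ([]; _∷_; lookup)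
open import Data.Vec.Properties using (lookup-zipWith; lookup∘tabulate; []=⇒lookup; lookup⇒[]=)
open import Function using (_∘_; id)
open import Function.Bundles using (_⇔_; mk⇔; Equivalence)
open import Relation.Binary.PropositionalEquality
open import Relation.Nullary using (Dec; yes; no; does)
open import Relation.Nullary.Decidable using (map′; _⊎-dec_; _×-dec_; dec-true)

open import Algebra.Properties.CommutativeMonoid.Sum +-0-commutativeMonoid
  using (sum; sum-cong-≗; sum-replicate-zero; ∑-distrib-+)
open Equivalence
open ≡-Reasoning

module _ {n : ℕ} {L : List (Edge n)} {I : Subset n} where

  ReachMod-trans : ∀ {u v w} → ReachMod L I u v → ReachMod L I v w → ReachMod L I u w
  ReachMod-trans here         q = q
  ReachMod-trans (fwd e p)    q = fwd e (ReachMod-trans p q)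
  ReachMod-trans (bwd e p)    q = bwd e (ReachMod-trans p q)
  ReachMod-trans (jump a b p) q = jump a b (ReachMod-trans p q)

  ReachMod-sym : ∀ {u v} → ReachMod L I u v → ReachMod L I v u
  ReachMod-sym here         = here
  ReachMod-sym (fwd e p)    = ReachMod-trans (ReachMod-sym p) (bwd e here)
  ReachMod-sym (bwd e p)    = ReachMod-trans (ReachMod-sym p) (fwd e here)
  ReachMod-sym (jump a b p) = ReachMod-trans (ReachMod-sym p) (jump b a here)

ReachMod-mono : ∀ {n} {L L′ : List (Edge n)} {I u v} →
                (∀ {e} → e LM.∈ L → e LM.∈ L′) → ReachMod L I u v → ReachMod L′ I u v
ReachMod-mono L⊆L′ here         = here
ReachMod-mono L⊆L′ (fwd e p)    = fwd (L⊆L′ e) (ReachMod-mono L⊆L′ p)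
ReachMod-mono L⊆L′ (bwd e p)    = bwd (L⊆L′ e) (ReachMod-mono L⊆L′ p)
ReachMod-mono L⊆L′ (jump a b p) = jump a b (ReachMod-mono L⊆L′ p)

ConnectedMod-mono : ∀ {n} {L L′ : List (Edge n)} {I} →
                    (∀ {e} → e LM.∈ L → e LM.∈ L′) → ConnectedMod L I → ConnectedMod L′ I
ConnectedMod-mono L⊆L′ connected u v = ReachMod-mono L⊆L′ (connected u v)

BlocksConnected : ∀ {n} → List (Edge n) → List (Subset n) → Set
BlocksConnected {n} L 𝒞 = ∀ {C} → C LM.∈ 𝒞 → ∀ (u v : Fin n) → u ∈ C → v ∈ C → Reach L u v

BlocksConnected-mono : ∀ {n} {L L′ : List (Edge n)} {𝒞} →
                       (∀ {e} → e LM.∈ L → e LM.∈ L′) → BlocksConnected L 𝒞 → BlocksConnected L′ 𝒞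
BlocksConnected-mono L⊆L′ blocks C∈𝒞 u v u∈C v∈C = ReachMod-mono L⊆L′ (blocks C∈𝒞 u v u∈C v∈C)

Reach-[] : ∀ {n} {u v : Fin n} → Reach [] u v → u ≡ v
Reach-[] here           = refl
Reach-[] (jump u∈⊥ _ _) = ⊥-elim (∉⊥ u∈⊥)

module _ {n : ℕ} {L : List (Edge n)} {a b : Fin n} where

  ThroughEdge : Fin n → Fin n → Set
  ThroughEdge u w = Reach L u w ⊎ (Reach L u a × Reach L b w) ⊎ (Reach L u b × Reach L a w)

  ThroughEdge-prepend : ∀ {u v w} → Reach L u v → ThroughEdge v w → ThroughEdge u w
  ThroughEdge-prepend r (inj₁ v⇝w)              = inj₁ (ReachMod-trans r v⇝w)
  ThroughEdge-prepend r (inj₂ (inj₁ (v⇝a , b⇝w))) = inj₂ (inj₁ (ReachMod-trans r v⇝a , b⇝w))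
  ThroughEdge-prepend r (inj₂ (inj₂ (v⇝b , a⇝w))) = inj₂ (inj₂ (ReachMod-trans r v⇝b , a⇝w))

  Reach-∷⁻ : ∀ {u w} → Reach ((a , b) ∷ L) u w → ThroughEdge u w
  Reach-∷⁻ here = inj₁ here
  Reach-∷⁻ (fwd (here refl) p) with Reach-∷⁻ p
  ... | inj₁ b⇝w                = inj₂ (inj₁ (here , b⇝w))
  ... | inj₂ (inj₁ (b⇝a , b⇝w)) = inj₁ (ReachMod-trans (ReachMod-sym b⇝a) b⇝w)
  ... | inj₂ (inj₂ (_ , a⇝w))   = inj₁ a⇝w
  Reach-∷⁻ (bwd (here refl) p) with Reach-∷⁻ p
  ... | inj₁ a⇝w                = inj₂ (inj₂ (here , a⇝w))
  ... | inj₂ (inj₁ (_ , b⇝w))   = inj₁ b⇝w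
  ... | inj₂ (inj₂ (a⇝b , a⇝w)) = inj₁ (ReachMod-trans (ReachMod-sym a⇝b) a⇝w)
  Reach-∷⁻ (fwd (there e) p) = ThroughEdge-prepend (fwd e here) (Reach-∷⁻ p)
  Reach-∷⁻ (bwd (there e) p) = ThroughEdge-prepend (bwd e here) (Reach-∷⁻ p)
  Reach-∷⁻ (jump u∈⊥ _ _)    = ⊥-elim (∉⊥ u∈⊥)

  Reach-∷⁺ : ∀ {u w} → ThroughEdge u w → Reach ((a , b) ∷ L) u w
  Reach-∷⁺ (inj₁ u⇝w)              = ReachMod-mono there u⇝w
  Reach-∷⁺ (inj₂ (inj₁ (u⇝a , b⇝w))) =
    ReachMod-trans (ReachMod-mono there u⇝a) (fwd (here refl) (ReachMod-mono there b⇝w))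
  Reach-∷⁺ (inj₂ (inj₂ (u⇝b , a⇝w))) =
    ReachMod-trans (ReachMod-mono there u⇝b) (bwd (here refl) (ReachMod-mono there a⇝w))

Reach? : ∀ {n} (L : List (Edge n)) (u w : Fin n) → Dec (Reach L u w)
Reach? []            u w with u ≟ w
... | yes refl = yes here
... | no u≢w   = no (u≢w ∘ Reach-[])
Reach? ((a , b) ∷ L) u w = map′ Reach-∷⁺ Reach-∷⁻
  (Reach? L u w ⊎-dec ((Reach? L u a ×-dec Reach? L b w) ⊎-dec (Reach? L u b ×-dec Reach? L a w)))

component : ∀ {n} → List (Edge n) → Fin n → Subset n
component L v = Vec.tabulate (λ w → does (Reach? L v w))

∈-component⇔ : ∀ {n} {L : List (Edge n)} {v w} → w ∈ component L v ⇔ Reach L v w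
∈-component⇔ {L = L} {v} {w} = mk⇔ reach
  (λ v⇝w → lookup⇒[]= w _ (trans (lookup∘tabulate _ w) (dec-true (Reach? L v w) v⇝w)))
  where
  reach : w ∈ component L v → Reach L v w
  reach w∈K with Reach? L v w | trans (sym (lookup∘tabulate _ w)) ([]=⇒lookup w∈K)
  ... | yes v⇝w | _ = v⇝w

∈-component-closed : ∀ {n} {L : List (Edge n)} {v x y} →
                     Reach L x y → x ∈ component L v → y ∈ component L v
∈-component-closed x⇝y x∈K = from ∈-component⇔ (ReachMod-trans (to ∈-component⇔ x∈K) x⇝y)

pick : ∀ {n} → Subset n → Fin n → Fin n
pick p d with nonempty? p
... | yes (x , _) = x
... | no _        = d

pick-∈ : ∀ {n} {p : Subset n} {x} d → x ∈ p → pick p d ∈ p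
pick-∈ {p = p} {x} d x∈p with nonempty? p
... | yes (_ , y∈p) = y∈p
... | no p-empty    = ⊥-elim (p-empty (x , x∈p))

pick-default-irrelevant : ∀ {n} {p : Subset n} {x} d d′ → x ∈ p → pick p d ≡ pick p d′
pick-default-irrelevant {p = p} {x} d d′ x∈p with nonempty? p
... | yes _      = refl
... | no p-empty = ⊥-elim (p-empty (x , x∈p))

Odd⇔parity≡1ℙ : ∀ k → Odd k ⇔ parity k ≡ 1ℙ
Odd⇔parity≡1ℙ 0                 = mk⇔ (λ ()) (λ ())
Odd⇔parity≡1ℙ 1                 = mk⇔ (λ _ → refl) (λ _ → refl)
Odd⇔parity≡1ℙ (ℕ.suc (ℕ.suc k)) = Odd⇔parity≡1ℙ k

Even⇔parity≡0ℙ : ∀ k → Even k ⇔ parity k ≡ 0ℙ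
Even⇔parity≡0ℙ 0                 = mk⇔ (λ _ → refl) (λ _ → refl)
Even⇔parity≡0ℙ 1                 = mk⇔ (λ ()) (λ ())
Even⇔parity≡0ℙ (ℕ.suc (ℕ.suc k)) = Even⇔parity≡0ℙ k

p≢1ℙ⇒p≡0ℙ : ∀ {p} → p ≢ 1ℙ → p ≡ 0ℙ
p≢1ℙ⇒p≡0ℙ {0ℙ} _    = refl
p≢1ℙ⇒p≡0ℙ {1ℙ} p≢1ℙ = ⊥-elim (p≢1ℙ refl)

+-cancel-middle : ∀ p q r → p + q + (q + r) ≡ p + r
+-cancel-middle p q r = begin
  p + q + (q + r)   ≡⟨ +-assoc p q (q + r) ⟩
  p + (q + (q + r)) ≡⟨ cong (p +_) (+-assoc q q r) ⟨
  p + (q + q + r)   ≡⟨ cong (λ s → p + (s + r)) (p+p≡0ℙ q) ⟩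
  p + r             ∎

δ : ∀ {n} → Fin n → Fin n → Parity
δ a x = parity (ind a x)

∂ : ∀ {n} → List (Edge n) → Fin n → Parity
∂ F x = parity (deg F x)

δ-refl : ∀ {n} (a : Fin n) → δ a a ≡ 1ℙ
δ-refl a with a ≟ a
... | yes _   = refl
... | no a≢a = ⊥-elim (a≢a refl)

δ-≢ : ∀ {n} {a x : Fin n} → a ≢ x → δ a x ≡ 0ℙ
δ-≢ {a = a} {x} a≢x with a ≟ x
... | yes a≡x = ⊥-elim (a≢x a≡x)
... | no _    = refl

δ-sym : ∀ {n} (a x : Fin n) → δ a x ≡ δ x a
δ-sym a x = by-cases (a ≟ x)
  where
  by-cases : Dec (a ≡ x) → δ a x ≡ δ x a
  by-cases (yes refl) = refl
  by-cases (no a≢x)   = trans (δ-≢ a≢x) (sym (δ-≢ (a≢x ∘ sym)))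

δ-suc : ∀ {n} (a x : Fin n) → δ (suc a) (suc x) ≡ δ a x
δ-suc a x = by-cases (a ≟ x)
  where
  by-cases : Dec (a ≡ x) → δ (suc a) (suc x) ≡ δ a x
  by-cases (yes refl) = trans (δ-refl (suc a)) (sym (δ-refl a))
  by-cases (no a≢x)   = trans (δ-≢ (a≢x ∘ suc-injective)) (sym (δ-≢ a≢x))

∂-∷ : ∀ {n} (a b : Fin n) L x → ∂ ((a , b) ∷ L) x ≡ δ a x + δ b x + ∂ L x
∂-∷ a b L x = begin
  parity (ind a x ℕ.+ ind b x ℕ.+ deg L x)   ≡⟨ +-homo-+ (ind a x ℕ.+ ind b x) (deg L x) ⟩
  parity (ind a x ℕ.+ ind b x) + ∂ L x       ≡⟨ cong (_+ ∂ L x) (+-homo-+ (ind a x) (ind b x)) ⟩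
  δ a x + δ b x + ∂ L x                      ∎

∂-++ : ∀ {n} (A B : List (Edge n)) x → ∂ (A ++ B) x ≡ ∂ A x + ∂ B x
∂-++ []            B x = refl
∂-++ ((a , b) ∷ A) B x = begin
  ∂ ((a , b) ∷ A ++ B) x            ≡⟨ ∂-∷ a b (A ++ B) x ⟩
  δ a x + δ b x + ∂ (A ++ B) x      ≡⟨ cong (δ a x + δ b x +_) (∂-++ A B x) ⟩
  δ a x + δ b x + (∂ A x + ∂ B x)   ≡⟨ +-assoc (δ a x + δ b x) (∂ A x) (∂ B x) ⟨
  δ a x + δ b x + ∂ A x + ∂ B x     ≡⟨ cong (_+ ∂ B x) (∂-∷ a b A x) ⟨
  ∂ ((a , b) ∷ A) x + ∂ B x         ∎

∂-++-doubled : ∀ {n} (L W : List (Edge n)) x → ∂ (L ++ L ++ W) x ≡ ∂ W x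
∂-++-doubled L W x = begin
  ∂ (L ++ L ++ W) x          ≡⟨ trans (∂-++ L (L ++ W) x) (cong (∂ L x +_) (∂-++ L W x)) ⟩
  ∂ L x + (∂ L x + ∂ W x)    ≡⟨ +-assoc (∂ L x) (∂ L x) (∂ W x) ⟨
  ∂ L x + ∂ L x + ∂ W x      ≡⟨ cong (_+ ∂ W x) (p+p≡0ℙ (∂ L x)) ⟩
  ∂ W x                      ∎

module _ {n : ℕ} {L : List (Edge n)} where

  walk : ∀ {u w} → Reach L u w → List (Edge n)
  walk here                 = []
  walk (fwd {u} {v} _ p)    = (u , v) ∷ walk p
  walk (bwd {u} {v} _ p)    = (v , u) ∷ walk p
  walk (jump u∈⊥ _ _)       = ⊥-elim (∉⊥ u∈⊥)

  walk⊆ : ∀ {u w} (p : Reach L u w) → All (LM._∈ L) (walk p)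
  walk⊆ here           = []
  walk⊆ (fwd e p)      = e ∷ walk⊆ p
  walk⊆ (bwd e p)      = e ∷ walk⊆ p
  walk⊆ (jump u∈⊥ _ _) = ⊥-elim (∉⊥ u∈⊥)

  ∂-walk : ∀ {u w} (p : Reach L u w) x → ∂ (walk p) x ≡ δ u x + δ w x
  ∂-walk {u} here x = sym (p+p≡0ℙ (δ u x))
  ∂-walk {u} {w} (fwd {v = v} _ p) x = begin
    ∂ ((u , v) ∷ walk p) x            ≡⟨ ∂-∷ u v (walk p) x ⟩
    δ u x + δ v x + ∂ (walk p) x      ≡⟨ cong (δ u x + δ v x +_) (∂-walk p x) ⟩
    δ u x + δ v x + (δ v x + δ w x)   ≡⟨ +-cancel-middle (δ u x) (δ v x) (δ w x) ⟩
    δ u x + δ w x                     ∎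
  ∂-walk {u} {w} (bwd {v = v} _ p) x = begin
    ∂ ((v , u) ∷ walk p) x            ≡⟨ ∂-∷ v u (walk p) x ⟩
    δ v x + δ u x + ∂ (walk p) x      ≡⟨ cong₂ _+_ (+-comm (δ v x) (δ u x)) (∂-walk p x) ⟩
    δ u x + δ v x + (δ v x + δ w x)   ≡⟨ +-cancel-middle (δ u x) (δ v x) (δ w x) ⟩
    δ u x + δ w x                     ∎
  ∂-walk (jump u∈⊥ _ _) = ⊥-elim (∉⊥ u∈⊥)

∂-concat-tabulate : ∀ {n m} (g : Fin m → List (Edge n)) x → ∂ (concat (tabulate g)) x ≡ sum (λ i → ∂ (g i) x)
∂-concat-tabulate {m = ℕ.zero}  g x = refl
∂-concat-tabulate {m = ℕ.suc m} g x =
  trans (∂-++ (g zero) _ x) (cong (∂ (g zero) x +_) (∂-concat-tabulate (g ∘ suc) x))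

χ : ∀ {n} → Subset n → Fin n → Parity
χ p x = if lookup p x then 1ℙ else 0ℙ

χ-∈ : ∀ {n} {p : Subset n} {x} → x ∈ p → χ p x ≡ 1ℙ
χ-∈ x∈p rewrite []=⇒lookup x∈p = refl

χ-∉ : ∀ {n} {p : Subset n} {x} → x ∉ p → χ p x ≡ 0ℙ
χ-∉ {p = p} {x} x∉p with lookup p x in eq
... | true  = ⊥-elim (x∉p (lookup⇒[]= x p eq))
... | false = refl

χ-∩ : ∀ {n} (p q : Subset n) x → χ (p ∩ q) x ≡ χ p x * χ q x
χ-∩ p q x rewrite lookup-zipWith _∧_ x p q with lookup p x
... | true  = refl
... | false = refl

parity∣p∣≡∑χ : ∀ {n} (p : Subset n) → parity ∣ p ∣ ≡ sum (χ p)
parity∣p∣≡∑χ []            = refl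
parity∣p∣≡∑χ (inside ∷ p)  = trans (+-homo-+ 1 ∣ p ∣) (cong (1ℙ +_) (parity∣p∣≡∑χ p))
parity∣p∣≡∑χ (outside ∷ p) = parity∣p∣≡∑χ p

χ-component-closed : ∀ {n} {L : List (Edge n)} v {x y} →
                     Reach L x y → χ (component L v) x ≡ χ (component L v) y
χ-component-closed {L = L} v {x} x⇝y with x ∈? component L v
... | yes x∈K = trans (χ-∈ x∈K) (sym (χ-∈ (∈-component-closed x⇝y x∈K)))
... | no x∉K  = trans (χ-∉ x∉K) (sym (χ-∉ (x∉K ∘ ∈-component-closed (ReachMod-sym x⇝y))))

∑-*δ : ∀ {n} (f : Fin n → Parity) a → sum (λ x → f x * δ a x) ≡ f a
∑-*δ {ℕ.suc n} f zero = begin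
  f zero * 1ℙ + sum (λ x → f (suc x) * 0ℙ)
    ≡⟨ cong₂ _+_ (*-identityʳ (f zero)) (sum-cong-≗ (*-zeroʳ ∘ f ∘ suc)) ⟩
  f zero + sum {n} (λ _ → 0ℙ)
    ≡⟨ cong (f zero +_) (sum-replicate-zero n) ⟩
  f zero + 0ℙ
    ≡⟨ +-identityʳ (f zero) ⟩
  f zero
    ∎
∑-*δ {ℕ.suc n} f (suc a) = begin
  f zero * 0ℙ + sum (λ x → f (suc x) * δ (suc a) (suc x))
    ≡⟨ cong₂ _+_ (*-zeroʳ (f zero)) (sum-cong-≗ (λ x → cong (f (suc x) *_) (δ-suc a x))) ⟩
  sum (λ x → f (suc x) * δ a x)
    ≡⟨ ∑-*δ (f ∘ suc) a ⟩
  f (suc a)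
    ∎

OddSetIs⇔∂≗χ : ∀ {n} (F : List (Edge n)) (T : Subset n) → OddSetIs F T ⇔ (∀ x → ∂ F x ≡ χ T x)
OddSetIs⇔∂≗χ F T = mk⇔ ∂≗χ oddSet
  where
  ∂≗χ : OddSetIs F T → ∀ x → ∂ F x ≡ χ T x
  ∂≗χ odd⇔∈ x with x ∈? T
  ... | yes x∈T = trans (to (Odd⇔parity≡1ℙ (deg F x)) (from (odd⇔∈ x) x∈T)) (sym (χ-∈ x∈T))
  ... | no x∉T  = trans (p≢1ℙ⇒p≡0ℙ (x∉T ∘ to (odd⇔∈ x) ∘ from (Odd⇔parity≡1ℙ (deg F x)))) (sym (χ-∉ x∉T))

  oddSet : (∀ x → ∂ F x ≡ χ T x) → OddSetIs F T
  oddSet ∂≗χ x = mk⇔ odd⇒∈ (λ x∈T → from (Odd⇔parity≡1ℙ (deg F x)) (trans (∂≗χ x) (χ-∈ x∈T)))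
    where
    odd⇒∈ : Odd (deg F x) → x ∈ T
    odd⇒∈ odd with x ∈? T
    ... | yes x∈T = x∈T
    ... | no x∉T  with () ← trans (sym (χ-∉ x∉T)) (trans (sym (∂≗χ x)) (to (Odd⇔parity≡1ℙ (deg F x)) odd))

OddSetIs-++-doubled : ∀ {n} (L : List (Edge n)) {W T} → OddSetIs W T → OddSetIs (L ++ L ++ W) T
OddSetIs-++-doubled L {W} {T} oddW =
  from (OddSetIs⇔∂≗χ (L ++ L ++ W) T) (λ x → trans (∂-++-doubled L W x) (to (OddSetIs⇔∂≗χ W T) oddW x))

∑-*∂-∷ : ∀ {n} (f : Fin n → Parity) a b F →
         sum (λ x → f x * ∂ ((a , b) ∷ F) x) ≡ f a + f b + sum (λ x → f x * ∂ F x)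
∑-*∂-∷ f a b F = begin
  sum (λ x → f x * ∂ ((a , b) ∷ F) x)
    ≡⟨ sum-cong-≗ distribute ⟩
  sum (λ x → f x * δ a x + f x * δ b x + f x * ∂ F x)
    ≡⟨ ∑-distrib-+ (λ x → f x * δ a x + f x * δ b x) (λ x → f x * ∂ F x) ⟩
  sum (λ x → f x * δ a x + f x * δ b x) + ∑f∂F
    ≡⟨ cong (_+ ∑f∂F) (∑-distrib-+ (λ x → f x * δ a x) (λ x → f x * δ b x)) ⟩
  sum (λ x → f x * δ a x) + sum (λ x → f x * δ b x) + ∑f∂F
    ≡⟨ cong₂ (λ p q → p + q + ∑f∂F) (∑-*δ f a) (∑-*δ f b) ⟩
  f a + f b + ∑f∂F
    ∎
  where
  ∑f∂F : Parity
  ∑f∂F = sum (λ x → f x * ∂ F x)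

  distribute : ∀ x → f x * ∂ ((a , b) ∷ F) x ≡ f x * δ a x + f x * δ b x + f x * ∂ F x
  distribute x = begin
    f x * ∂ ((a , b) ∷ F) x                    ≡⟨ cong (f x *_) (∂-∷ a b F x) ⟩
    f x * (δ a x + δ b x + ∂ F x)              ≡⟨ *-distribˡ-+ (f x) (δ a x + δ b x) (∂ F x) ⟩
    f x * (δ a x + δ b x) + f x * ∂ F x        ≡⟨ cong (_+ f x * ∂ F x) (*-distribˡ-+ (f x) (δ a x) (δ b x)) ⟩
    f x * δ a x + f x * δ b x + f x * ∂ F x    ∎

handshake : ∀ {n} (f : Fin n → Parity) (F : List (Edge n)) →
            (∀ {a b} → (a , b) LM.∈ F → f a ≡ f b) → sum (λ x → f x * ∂ F x) ≡ 0ℙ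
handshake {n} f [] _ = trans (sum-cong-≗ (*-zeroʳ ∘ f)) (sum-replicate-zero n)
handshake f ((a , b) ∷ F) f-const = begin
  sum (λ x → f x * ∂ ((a , b) ∷ F) x)   ≡⟨ ∑-*∂-∷ f a b F ⟩
  f a + f b + sum (λ x → f x * ∂ F x)   ≡⟨ cong₂ (λ q s → f a + q + s) (sym (f-const (here refl))) (handshake f F (f-const ∘ there)) ⟩
  f a + f a + 0ℙ                        ≡⟨ cong (_+ 0ℙ) (p+p≡0ℙ (f a)) ⟩
  0ℙ                                    ∎

T-join⇒CompsEvenT : ∀ {n} (G : WGraph n) {F : List (Edge n)} {T : Subset n} →
                    All (LM._∈ edges G) F → OddSetIs F T → CompsEvenT G T
T-join⇒CompsEvenT G {F} {T} F⊆E oddF v = K ∩ T , (λ w → mk⇔ ∩⁻ ∩⁺) , evenK∩T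
  where
  K : Subset _
  K = component (edges G) v

  ∩⁻ : ∀ {w} → w ∈ K ∩ T → w ∈ T × Reach (edges G) v w
  ∩⁻ w∈K∩T with w∈K , w∈T ← x∈p∩q⁻ K T w∈K∩T = w∈T , to ∈-component⇔ w∈K

  ∩⁺ : ∀ {w} → w ∈ T × Reach (edges G) v w → w ∈ K ∩ T
  ∩⁺ (w∈T , v⇝w) = x∈p∩q⁺ (from ∈-component⇔ v⇝w , w∈T)

  evenK∩T : Even ∣ K ∩ T ∣
  evenK∩T = from (Even⇔parity≡0ℙ ∣ K ∩ T ∣) (begin
    parity ∣ K ∩ T ∣            ≡⟨ parity∣p∣≡∑χ (K ∩ T) ⟩
    sum (χ (K ∩ T))
      ≡⟨ sum-cong-≗ (λ x → trans (χ-∩ K T x) (cong (χ K x *_) (sym (to (OddSetIs⇔∂≗χ F T) oddF x)))) ⟩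
    sum (λ x → χ K x * ∂ F x)
      ≡⟨ handshake (χ K) F (λ ab∈F → χ-component-closed v (fwd (All.lookup F⊆E ab∈F) here)) ⟩
    0ℙ                          ∎)

module T-joinConstruction {n} (G : WGraph n) (T : Subset n) (evenT : CompsEvenT G T) where

  E : List (Edge n)
  E = edges G

  S : Fin n → Subset n
  S x = proj₁ (evenT x)

  ∈S⇔ : ∀ x {w} → w ∈ S x ⇔ (w ∈ T × Reach E x w)
  ∈S⇔ x {w} = proj₁ (proj₂ (evenT x)) w

  S-reach : ∀ {x y} → Reach E x y → S x ≡ S y
  S-reach {x} {y} x⇝y = ⊆-antisym
    (λ w∈Sx → let w∈T , x⇝w = to (∈S⇔ x) w∈Sx
              in from (∈S⇔ y) (w∈T , ReachMod-trans (ReachMod-sym x⇝y) x⇝w))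
    (λ w∈Sy → let w∈T , y⇝w = to (∈S⇔ y) w∈Sy
              in from (∈S⇔ x) (w∈T , ReachMod-trans x⇝y y⇝w))

  rep : Fin n → Fin n
  rep x = pick (S x) x

  x∈Sx : ∀ {x} → x ∈ T → x ∈ S x
  x∈Sx x∈T = from (∈S⇔ _) (x∈T , here)

  reach-rep : ∀ {x} → x ∈ T → Reach E x (rep x)
  reach-rep {x} x∈T = proj₂ (to (∈S⇔ x) (pick-∈ x (x∈Sx x∈T)))

  rep-resp-Reach : ∀ {x y} → x ∈ T → Reach E x y → rep x ≡ rep y
  rep-resp-Reach {x} {y} x∈T x⇝y =
    trans (pick-default-irrelevant x y (x∈Sx x∈T)) (cong (λ p → pick p y) (S-reach x⇝y))

  same-rep⇒Reach : ∀ {x y} → x ∈ T → y ∈ T → rep x ≡ rep y → Reach E x y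
  same-rep⇒Reach {y = y} x∈T y∈T rep-x≡rep-y =
    ReachMod-trans (reach-rep x∈T) (subst (λ z → Reach E z y) (sym rep-x≡rep-y) (ReachMod-sym (reach-rep y∈T)))

  detour : (x : Fin n) → Dec (x ∈ T) → List (Edge n)
  detour x (yes x∈T) = walk (reach-rep x∈T)
  detour x (no _)    = []

  W : List (Edge n)
  W = concat (tabulate (λ x → detour x (x ∈? T)))

  W⊆E : All (LM._∈ E) W
  W⊆E = concat⁺ (tabulate⁺ (λ x → detour⊆E x (x ∈? T)))
    where
    detour⊆E : ∀ x x∈?T → All (LM._∈ E) (detour x x∈?T)
    detour⊆E x (yes x∈T) = walk⊆ (reach-rep x∈T)
    detour⊆E x (no _)    = []

  ∂-detour : ∀ x y → ∂ (detour x (x ∈? T)) y ≡ χ T x * (δ x y + δ (rep x) y)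
  ∂-detour x y with x ∈? T
  ... | yes x∈T = trans (∂-walk (reach-rep x∈T) y) (sym (cong (_* (δ x y + δ (rep x) y)) (χ-∈ x∈T)))
  ... | no x∉T  = sym (cong (_* (δ x y + δ (rep x) y)) (χ-∉ x∉T))

  ∑-χ*δ-rep≡0ℙ : ∀ y → sum (λ x → χ T x * δ (rep x) y) ≡ 0ℙ
  ∑-χ*δ-rep≡0ℙ y with any? (λ x → (x ∈? T) ×-dec (rep x ≟ y))
  ... | yes (x₀ , x₀∈T , rep-x₀≡y) = begin
    sum (λ x → χ T x * δ (rep x) y)   ≡⟨ sum-cong-≗ (λ x → fibre≗S x (x ∈? T) (rep x ≟ y)) ⟩
    sum (χ (S x₀))                    ≡⟨ parity∣p∣≡∑χ (S x₀) ⟨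
    parity ∣ S x₀ ∣                   ≡⟨ to (Even⇔parity≡0ℙ ∣ S x₀ ∣) (proj₂ (proj₂ (evenT x₀))) ⟩
    0ℙ                                ∎
    where
    fibre≗S : ∀ x → Dec (x ∈ T) → Dec (rep x ≡ y) → χ T x * δ (rep x) y ≡ χ (S x₀) x
    fibre≗S x (yes x∈T) (yes rep-x≡y) =
      trans (cong₂ _*_ (χ-∈ x∈T) (trans (cong (λ z → δ z y) rep-x≡y) (δ-refl y)))
            (sym (χ-∈ (from (∈S⇔ x₀) (x∈T , same-rep⇒Reach x₀∈T x∈T (trans rep-x₀≡y (sym rep-x≡y))))))
    fibre≗S x (yes x∈T) (no rep-x≢y) =
      trans (cong₂ _*_ (χ-∈ x∈T) (δ-≢ rep-x≢y))
            (sym (χ-∉ (λ x∈Sx₀ → rep-x≢y (trans (sym (rep-resp-Reach x₀∈T (proj₂ (to (∈S⇔ x₀) x∈Sx₀)))) rep-x₀≡y))))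
    fibre≗S x (no x∉T) _ =
      trans (cong (_* δ (rep x) y) (χ-∉ x∉T)) (sym (χ-∉ (x∉T ∘ proj₁ ∘ to (∈S⇔ x₀))))
  ... | no ∄x = trans (sum-cong-≗ (λ x → vanish x (x ∈? T))) (sum-replicate-zero n)
    where
    vanish : ∀ x → Dec (x ∈ T) → χ T x * δ (rep x) y ≡ 0ℙ
    vanish x (yes x∈T) =
      trans (cong (χ T x *_) (δ-≢ (λ rep-x≡y → ∄x (x , x∈T , rep-x≡y)))) (*-zeroʳ (χ T x))
    vanish x (no x∉T)  = cong (_* δ (rep x) y) (χ-∉ x∉T)

  ∂W≗χT : ∀ y → ∂ W y ≡ χ T y
  ∂W≗χT y = begin
    ∂ W y
      ≡⟨ ∂-concat-tabulate (λ x → detour x (x ∈? T)) y ⟩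
    sum (λ x → ∂ (detour x (x ∈? T)) y)
      ≡⟨ sum-cong-≗ (λ x → trans (∂-detour x y) (*-distribˡ-+ (χ T x) (δ x y) (δ (rep x) y))) ⟩
    sum (λ x → χ T x * δ x y + χ T x * δ (rep x) y)
      ≡⟨ ∑-distrib-+ (λ x → χ T x * δ x y) (λ x → χ T x * δ (rep x) y) ⟩
    sum (λ x → χ T x * δ x y) + sum (λ x → χ T x * δ (rep x) y)
      ≡⟨ cong₂ _+_ (sum-cong-≗ (λ x → cong (χ T x *_) (δ-sym x y))) (∑-χ*δ-rep≡0ℙ y) ⟩
    sum (λ x → χ T x * δ y x) + 0ℙ
      ≡⟨ cong (_+ 0ℙ) (∑-*δ (χ T) y) ⟩
    χ T y + 0ℙ
      ≡⟨ +-identityʳ (χ T y) ⟩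
    χ T y
      ∎

CompsEvenT⇒T-join : ∀ {n} (G : WGraph n) {T : Subset n} → CompsEvenT G T →
                    ∃ λ W → All (LM._∈ edges G) W × OddSetIs W T
CompsEvenT⇒T-join G {T} evenT = W , W⊆E , from (OddSetIs⇔∂≗χ W T) ∂W≗χT
  where open T-joinConstruction G T evenT

lemma3p4 : ∀ {n : ℕ} (G : WGraph n) (Φ : Interface G) →
    HasTour G Φ ⇔
      (CompsEvenT G (T Φ) ×
       ConnectedMod (edges G) (I Φ) ×
       (∀ {C} → C LM.∈ 𝒞 Φ → ∀ (u v : Fin n) → u ∈ C → v ∈ C → Reach (edges G) u v))
lemma3p4 G Φ = mk⇔ tour⇒conditions conditions⇒tour
  where
  E : List (Edge _)
  E = edges G

  tour⇒conditions : HasTour G Φ → CompsEvenT G (T Φ) × ConnectedMod E (I Φ) × BlocksConnected E (𝒞 Φ)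
  tour⇒conditions (F , F⊆E , oddF , connected , blocks) =
    T-join⇒CompsEvenT G F⊆E oddF ,
    ConnectedMod-mono (All.lookup F⊆E) connected ,
    BlocksConnected-mono (All.lookup F⊆E) blocks

  conditions⇒tour : CompsEvenT G (T Φ) × ConnectedMod E (I Φ) × BlocksConnected E (𝒞 Φ) → HasTour G Φ
  conditions⇒tour (evenT , connected , blocks) with W , W⊆E , oddW ← CompsEvenT⇒T-join G evenT =
    E ++ E ++ W ,
    ++⁺ (All.tabulate id) (++⁺ (All.tabulate id) W⊆E) ,
    OddSetIs-++-doubled E oddW ,
    ConnectedMod-mono ∈-++⁺ˡ connected ,
    BlocksConnected-mono ∈-++⁺ˡ blocks
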